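{- For every positive integer $n$, $\Psi(Q_n)\le \Psi(Q_{n+1})\le \Psi(Q_n)+1$.
   Context: $Q_n$ is the $n$-dimensional hypercube: vertex set $\{0,1\}^n$, two vertices adjacent iff they differ in exactly one coordinate. A set $S$ of vertices of a graph $G$ is doubly resolving if for all distinct vertices $u,v$ there are $x,y\in S$ with $d_G(u,x)-d_G(u,y)\neq d_G(v,x)-d_G(v,y)$; $\Psi(G)$ is the minimum cardinality of a doubly resolving set. -}

module Defs where

open import Data.Nat using (ℕ; zero; suc; _+_; _≤_)
open import Data.Bool using (Bool; true; false)
open import Data.Vec using (Vec; []; _∷_)
open import Data.Integer using (ℤ; +_; _-_)
open import Data.List using (List; length)
open import Data.List.Membership.Propositional using (_∈_)
open import Data.List.Relation.Unary.Unique.Propositional using (Unique)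
open import Data.Product using (Σ; _×_; ∃-syntax)
open import Relation.Binary.PropositionalEquality using (_≡_; _≢_)

-- Vertices of the hypercube Q_n: binary words of length n.
Vertex : ℕ → Set
Vertex n = Vec Bool n

-- Graph distance in Q_n, which is the Hamming distance
-- (number of coordinates in which the two words differ).
dist : {n : ℕ} → Vertex n → Vertex n → ℕ
dist [] [] = 0
dist (true ∷ u) (true ∷ v) = dist u v
dist (false ∷ u) (false ∷ v) = dist u v
dist (true ∷ u) (false ∷ v) = suc (dist u v)
dist (false ∷ u) (true ∷ v) = suc (dist u v)

-- A set of vertices, represented as a duplicate-free list (cardinality = length).
DoublyResolving : (n : ℕ) → List (Vertex n) → Set
DoublyResolving n S =
  (u v : Vertex n) → u ≢ v →
  ∃[ x ] ∃[ y ] (x ∈ S × y ∈ S ×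
    ((+ dist u x) - (+ dist u y)) ≢ ((+ dist v x) - (+ dist v y)))

IsPsi : ℕ → ℕ → Set
IsPsi n k =
  (Σ (List (Vertex n)) λ S → Unique S × DoublyResolving n S × length S ≡ k)
  × ((S : List (Vertex n)) → Unique S → DoublyResolving n S → k ≤ length S)

{-# OPTIONS --safe #-}

-- Deleting the first coordinate maps a doubly resolving set of Q_{n+1} onto
-- one of Q_n: prepending a common bit to u and v shifts d(u,x) - d(u,y) and
-- d(v,x) - d(v,y) by the same amount.  Conversely, if S doubly resolves Q_n
-- and s ∈ S (S ≠ ∅ as n ≥ 1), then 0S ∪ {1s} doubly resolves Q_{n+1}:
-- vertices au, bv with u ≠ v are separated by the pair from 0S separating u
-- and v, and 0u, 1u by (1s, 0s).

module Submission where

open import Defs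
open import Data.Nat using (ℕ; suc; _+_; _≤_)
open import Data.Product using (_×_; _,_; ∃-syntax)

open import Data.Nat.Properties using (≤-trans; ≤-reflexive; +-comm)
open import Data.Bool using (Bool; true; false)
import Data.Bool.Properties as Bool
open import Data.Vec using ([]; _∷_; [_]; _++_; tail; replicate)
open import Data.Vec.Properties using (≡-dec; ∷-injectiveʳ)
open import Data.Integer as ℤ using (ℤ; +_; 0ℤ)
open import Data.Integer.Properties using (pos-+; +-inverseʳ; +-identityˡ; +-0-abelianGroup)
open import Algebra.Properties.AbelianGroup +-0-abelianGroup using (∙-cancelʳ)
open import Data.Integer.Tactic.RingSolver using (solve-∀)
open import Data.List using (List; _∷_; length; map; deduplicate)
open import Data.List.Properties using (length-map; length-deduplicate)
open import Data.List.Membership.Propositional using (_∈_)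
open import Data.List.Membership.Propositional.Properties using (∈-map⁺; ∈-deduplicate⁺)
open import Data.List.Relation.Binary.Subset.Propositional using (_⊆_)
open import Data.List.Relation.Unary.Any using (here; there)
open import Data.List.Relation.Unary.Unique.DecPropositional.Properties using (deduplicate-!)
open import Function using (_∘_)
open import Relation.Binary.Definitions using (DecidableEquality)
open import Relation.Binary.PropositionalEquality using (_≡_; refl; sym; trans; cong; cong₂; module ≡-Reasoning)
open import Relation.Nullary using (yes; no)

private
  variable
    m n k : ℕ

_≟_ : DecidableEquality (Vertex n)
_≟_ = ≡-dec Bool._≟_

distDiff : Vertex n → Vertex n → Vertex n → ℤ
distDiff u x y = + dist u x ℤ.- + dist u y

dist-++ : (u x : Vertex m) {u′ x′ : Vertex n} →
  dist (u ++ u′) (x ++ x′) ≡ dist u x + dist u′ x′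
dist-++ []         []         = refl
dist-++ (true ∷ u)  (true ∷ x)  = dist-++ u x
dist-++ (false ∷ u) (false ∷ x) = dist-++ u x
dist-++ (true ∷ u)  (false ∷ x) = cong suc (dist-++ u x)
dist-++ (false ∷ u) (true ∷ x)  = cong suc (dist-++ u x)

distDiff-++ : (u x y : Vertex m) {u′ x′ y′ : Vertex n} →
  distDiff (u ++ u′) (x ++ x′) (y ++ y′) ≡ distDiff u x y ℤ.+ distDiff u′ x′ y′
distDiff-++ u x y {u′} {x′} {y′} = begin
  + dist (u ++ u′) (x ++ x′) ℤ.- + dist (u ++ u′) (y ++ y′)
    ≡⟨ cong₂ ℤ._-_ (cong +_ (dist-++ u x)) (cong +_ (dist-++ u y)) ⟩
  + (dist u x + dist u′ x′) ℤ.- + (dist u y + dist u′ y′)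
    ≡⟨ cong₂ ℤ._-_ (pos-+ (dist u x) _) (pos-+ (dist u y) _) ⟩
  (+ dist u x ℤ.+ + dist u′ x′) ℤ.- (+ dist u y ℤ.+ + dist u′ y′)
    ≡⟨ interchange (+ dist u x) (+ dist u′ x′) (+ dist u y) (+ dist u′ y′) ⟩
  distDiff u x y ℤ.+ distDiff u′ x′ y′
    ∎
  where
  open ≡-Reasoning
  interchange : (i j k l : ℤ) → (i ℤ.+ j) ℤ.- (k ℤ.+ l) ≡ (i ℤ.- k) ℤ.+ (j ℤ.- l)
  interchange = solve-∀

distDiff-self : (u x : Vertex n) → distDiff u x x ≡ 0ℤ
distDiff-self u x = +-inverseʳ (+ dist u x)

distDiff-++-commonPrefix : (u x : Vertex m) {u′ x′ y′ : Vertex n} →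
  distDiff (u ++ u′) (x ++ x′) (x ++ y′) ≡ distDiff u′ x′ y′
distDiff-++-commonPrefix u x {u′} {x′} {y′} = begin
  distDiff (u ++ u′) (x ++ x′) (x ++ y′)   ≡⟨ distDiff-++ u x x ⟩
  distDiff u x x ℤ.+ distDiff u′ x′ y′     ≡⟨ cong (ℤ._+ _) (distDiff-self u x) ⟩
  0ℤ ℤ.+ distDiff u′ x′ y′                 ≡⟨ +-identityˡ _ ⟩
  distDiff u′ x′ y′                        ∎
  where open ≡-Reasoning

distDiff-antipodal-injective : (a b : Bool) →
  distDiff [ a ] [ true ] [ false ] ≡ distDiff [ b ] [ true ] [ false ] → a ≡ b
distDiff-antipodal-injective true  true  _ = refl
distDiff-antipodal-injective false false _ = refl

DoublyResolving-mono : {S T : List (Vertex n)} → S ⊆ T →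
  DoublyResolving n S → DoublyResolving n T
DoublyResolving-mono S⊆T resolving u v u≢v with resolving u v u≢v
... | x , y , x∈S , y∈S , separates = x , y , S⊆T x∈S , S⊆T y∈S , separates

DoublyResolving-nonempty : {S : List (Vertex (suc n))} →
  DoublyResolving (suc n) S → ∃[ s ] s ∈ S
DoublyResolving-nonempty resolving
  with resolving (true ∷ replicate _ false) (false ∷ replicate _ false) (λ ())
... | x , _ , x∈S , _ = x , x∈S

IsPsi⇒≤length : IsPsi n k → {S : List (Vertex n)} → DoublyResolving n S → k ≤ length S
IsPsi⇒≤length (_ , minimal) {S} resolving = ≤-trans
  (minimal (deduplicate _≟_ S) (deduplicate-! _≟_ S)
    (DoublyResolving-mono (∈-deduplicate⁺ _≟_) resolving))
  (length-deduplicate _≟_ S)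

DoublyResolving-tail : {S : List (Vertex (suc n))} →
  DoublyResolving (suc n) S → DoublyResolving n (map tail S)
DoublyResolving-tail resolving u v u≢v
  with resolving (false ∷ u) (false ∷ v) (u≢v ∘ ∷-injectiveʳ)
... | c ∷ x , e ∷ y , x∈S , y∈S , separates =
  x , y , ∈-map⁺ tail x∈S , ∈-map⁺ tail y∈S , λ eq → separates (begin
    distDiff (false ∷ u) (c ∷ x) (e ∷ y)              ≡⟨ distDiff-++ [ false ] [ c ] [ e ] ⟩
    distDiff [ false ] [ c ] [ e ] ℤ.+ distDiff u x y ≡⟨ cong (ℤ._+_ (distDiff [ false ] [ c ] [ e ])) eq ⟩
    distDiff [ false ] [ c ] [ e ] ℤ.+ distDiff v x y ≡⟨ distDiff-++ [ false ] [ c ] [ e ] ⟨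
    distDiff (false ∷ v) (c ∷ x) (e ∷ y)              ∎)
  where open ≡-Reasoning

extend : Vertex n → List (Vertex n) → List (Vertex (suc n))
extend s S = (true ∷ s) ∷ map (false ∷_) S

DoublyResolving-extend : {s : Vertex n} {S : List (Vertex n)} → s ∈ S →
  DoublyResolving n S → DoublyResolving (suc n) (extend s S)
DoublyResolving-extend {s = s} s∈S resolving (a ∷ u) (b ∷ v) au≢bv with u ≟ v
... | yes refl = true ∷ s , false ∷ s , here refl , there (∈-map⁺ _ s∈S) ,
  λ eq → au≢bv (cong (_∷ u) (distDiff-antipodal-injective a b (∙-cancelʳ (distDiff u s s) _ _
    (trans (sym (distDiff-++ [ a ] [ true ] [ false ])) (trans eq (distDiff-++ [ b ] [ true ] [ false ]))))))
... | no u≢v with resolving u v u≢v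
... | x , y , x∈S , y∈S , separates =
  false ∷ x , false ∷ y , there (∈-map⁺ _ x∈S) , there (∈-map⁺ _ y∈S) ,
  λ eq → separates (trans (sym (distDiff-++-commonPrefix [ a ] [ false ]))
    (trans eq (distDiff-++-commonPrefix [ b ] [ false ])))

length-extend : (s : Vertex n) (S : List (Vertex n)) → length (extend s S) ≡ length S + 1
length-extend s S = trans (cong suc (length-map (false ∷_) S)) (+-comm 1 (length S))

theorem9 : (n : ℕ) → 1 ≤ n → (a b : ℕ) → IsPsi n a → IsPsi (suc n) b →
    a ≤ b × b ≤ a + 1
theorem9 (suc n) _ a b psiA@((S , _ , S-resolving , refl) , _) psiB@((S′ , _ , S′-resolving , refl) , _)
  with DoublyResolving-nonempty S-resolving
... | s , s∈S =
  ≤-trans (IsPsi⇒≤length psiA (DoublyResolving-tail S′-resolving)) (≤-reflexive (length-map tail S′)) ,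
  ≤-trans (IsPsi⇒≤length psiB (DoublyResolving-extend s∈S S-resolving)) (≤-reflexive (length-extend s S))
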